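{- Let $R$ be a commutative ring with identity and let $I$ be an ideal of $R$ with $I\not\subseteq\mathrm{Z}(R)$. If $\mathrm{diam}(\Gamma(R\Join I))=2$, then for every $y\in\mathrm{Z}(R)\setminus\{0\}$ we have $\mathrm{Ann}_R(y)\cap I\neq\{0\}$.
   Context: $R\Join I=\{(r,r+i)\mid r\in R,\ i\in I\}$ is the subring of $R\times R$ (componentwise operations), called the amalgamated duplication of $R$ along $I$. $\mathrm{Z}(A)$ denotes the set of zero-divisors of a ring $A$ (including $0$); $\mathrm{Ann}_R(y)=\{r\in R\mid ry=0\}$. $\Gamma(A)$ is the zero-divisor graph: its vertices are the non-zero zero-divisors of $A$, and distinct vertices $x,y$ are adjacent iff $xy=0$; it is connected, and its diameter is the supremum of the distances (lengths of shortest paths) between its vertices. -}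

module Defs where

open import Level using (Level; _⊔_)
open import Data.Nat using (ℕ; zero; suc; _≤_)
open import Data.Product using (Σ; ∃; _×_; _,_; proj₁; proj₂)
open import Data.Sum using (_⊎_)
open import Relation.Nullary using (¬_)
open import Algebra.Bundles using (CommutativeRing)

record Ideal {c ℓ : Level} (R : CommutativeRing c ℓ) (p : Level) : Set (c ⊔ ℓ ⊔ Level.suc p) where
  open CommutativeRing R
  field
    _∈I      : Carrier → Set p
    resp     : ∀ {x y} → x ≈ y → x ∈I → y ∈I
    0∈I      : 0# ∈I
    +-closed : ∀ {x y} → x ∈I → y ∈I → (x + y) ∈I
    *-closed : ∀ r {x} → x ∈I → (r * x) ∈I

module _ {c ℓ : Level} (R : CommutativeRing c ℓ) where
  open CommutativeRing R

  ZeroDivisor : Carrier → Set (c ⊔ ℓ)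
  ZeroDivisor x = (x ≈ 0#) ⊎ (Σ Carrier λ y → (¬ (y ≈ 0#)) × (x * y ≈ 0#))

  Ann : Carrier → Carrier → Set ℓ
  Ann y r = r * y ≈ 0#

module _ {a ℓ v e : Level} {A : Set a} (_≈_ : A → A → Set ℓ)
         (V : A → Set v) (Adj : A → A → Set e) where

  data Walk : A → A → ℕ → Set (a ⊔ ℓ ⊔ e) where
    here : ∀ {x y} → x ≈ y → Walk x y zero
    step : ∀ {x z y k} → Adj x z → Walk z y k → Walk x y (suc k)

  DistLe : A → A → ℕ → Set (a ⊔ ℓ ⊔ e)
  DistLe x y k = Σ ℕ λ j → (j ≤ k) × Walk x y j

  DiamEq2 : Set (a ⊔ ℓ ⊔ v ⊔ e)
  DiamEq2 = (∀ x y → V x → V y → DistLe x y 2)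
          × (Σ A λ x → Σ A λ y → V x × V y × ¬ DistLe x y 1)

module Dup {c ℓ p : Level} (R : CommutativeRing c ℓ) (I : Ideal R p) where
  open CommutativeRing R
  open Ideal I

  D : Set (c ⊔ ℓ ⊔ p)
  D = Σ (Carrier × Carrier) λ q → Σ Carrier λ i → (i ∈I) × (proj₂ q ≈ proj₁ q + i)

  _≈D_ : D → D → Set ℓ
  ((a , b) , _) ≈D ((a' , b') , _) = (a ≈ a') × (b ≈ b')

  _*D_ : D → D → Carrier × Carrier
  ((a , b) , _) *D ((a' , b') , _) = (a * a' , b * b')

  ProdZero : D → D → Set ℓ
  ProdZero x y = (proj₁ (x *D y) ≈ 0#) × (proj₂ (x *D y) ≈ 0#)

  IsZeroD : D → Set ℓ
  IsZeroD ((a , b) , _) = (a ≈ 0#) × (b ≈ 0#)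

  Vertex : D → Set (c ⊔ ℓ ⊔ p)
  Vertex x = (¬ IsZeroD x) × (Σ D λ y → (¬ IsZeroD y) × ProdZero x y)

  Adjacent : D → D → Set (c ⊔ ℓ ⊔ p)
  Adjacent x y = Vertex x × Vertex y × (¬ (x ≈D y)) × ProdZero x y

  DiamΓ≡2 : Set (c ⊔ ℓ ⊔ p)
  DiamΓ≡2 = DiamEq2 _≈D_ Vertex Adjacent

{-# OPTIONS --safe #-}
module Submission where

-- Take a regular element i ∈ I and a non-zero zero-divisor y. Then (y, y) and (0, i) are
-- vertices of Γ(R ⋈ I), and they are neither equal nor adjacent, since y i ≠ 0. A common
-- neighbour (a, b) satisfies b i = 0, hence b = 0, hence a = -j ∈ I for the j with b = a + j;
-- together with a y = 0 this makes a a non-zero element of Ann_R(y) ∩ I.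

open import Defs
open import Level using (Level)
open import Data.Product using (Σ; _×_; _,_; proj₁; proj₂)
open import Data.Sum using (inj₁; inj₂)
open import Data.Empty using (⊥-elim)
open import Data.Nat using (s≤s)
open import Relation.Nullary using (¬_)
open import Algebra.Bundles using (CommutativeRing)
import Algebra.Properties.Ring as RingProperties
import Algebra.Properties.Group as GroupProperties
import Relation.Binary.Reasoning.Setoid as SetoidReasoning

module _ {a ℓ v e : Level} {A : Set a} {_≈_ : A → A → Set ℓ}
         {V : A → Set v} {Adj : A → A → Set e} where

  ¬DistLe2 : ∀ {x y} → ¬ x ≈ y
           → (∀ z → Adj x z → ¬ z ≈ y)
           → (∀ z w → Adj x z → Adj z w → ¬ w ≈ y)
           → ¬ DistLe _≈_ V Adj x y 2
  ¬DistLe2 x≉y _ _ (_ , _ , here x≈y) = x≉y x≈y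
  ¬DistLe2 _ ¬adj₁ _ (_ , _ , step xz (here z≈y)) = ¬adj₁ _ xz z≈y
  ¬DistLe2 _ _ ¬adj₂ (_ , _ , step xz (step zw (here w≈y))) = ¬adj₂ _ _ xz zw w≈y
  ¬DistLe2 _ _ _ (_ , s≤s (s≤s ()) , step _ (step _ (step _ _)))

module _ {c ℓ : Level} (R : CommutativeRing c ℓ) where
  open CommutativeRing R

  ¬ZeroDivisor⇒≉0 : ∀ {r} → ¬ ZeroDivisor R r → ¬ r ≈ 0#
  ¬ZeroDivisor⇒≉0 r-reg r≈0 = r-reg (inj₁ r≈0)

  -- Only ¬ ¬ (x ≈ 0#), since ZeroDivisor asks of its witness merely that it be ¬ ≈ 0#.
  ¬ZeroDivisor⇒Ann≈0 : ∀ {r x} → ¬ ZeroDivisor R r → Ann R r x → ¬ ¬ (x ≈ 0#)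
  ¬ZeroDivisor⇒Ann≈0 {r} {x} r-reg xr≈0 x≉0 = r-reg (inj₂ (x , x≉0 , trans (*-comm r x) xr≈0))

  module _ {p : Level} (I : Ideal R p) where
    open Ideal I
    open RingProperties ring using (-1*x≈-x)

    -‿closed : ∀ {x} → x ∈I → (- x) ∈I
    -‿closed {x} x∈I = resp (-1*x≈-x x) (*-closed (- 1#) x∈I)

module ZeroDivisorGraph {c ℓ p : Level} (R : CommutativeRing c ℓ) (I : Ideal R p) where
  open CommutativeRing R
  open Ideal I
  open Dup R I
  open GroupProperties +-group using (inverseˡ-unique)
  open SetoidReasoning setoid

  diag : Carrier → D
  diag r = (r , r) , 0# , 0∈I , sym (+-identityʳ r)

  ⟨0,_⟩ : ∀ {i} → i ∈I → D
  ⟨0,_⟩ {i} i∈I = (0# , i) , i , i∈I , sym (+-identityˡ i)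

  ⟨_,0⟩ : ∀ {i} → i ∈I → D
  ⟨_,0⟩ {i} i∈I = (i , 0#) , - i , -‿closed R I i∈I , sym (-‿inverseʳ i)

  snd≈0⇒fst∈I : (z : D) → proj₂ (proj₁ z) ≈ 0# → proj₁ (proj₁ z) ∈I
  snd≈0⇒fst∈I ((a , b) , j , j∈I , b≈a+j) b≈0 =
    resp (sym (inverseˡ-unique a j (trans (sym b≈a+j) b≈0))) (-‿closed R I j∈I)

  diag-vertex : ∀ {y} → ZeroDivisor R y → ¬ y ≈ 0# → Vertex (diag y)
  diag-vertex (inj₁ y≈0) y≉0 = ⊥-elim (y≉0 y≈0)
  diag-vertex (inj₂ (z , z≉0 , yz≈0)) y≉0 =
    (λ y,y≈0 → y≉0 (proj₁ y,y≈0)) , diag z , (λ z,z≈0 → z≉0 (proj₁ z,z≈0)) , yz≈0 , yz≈0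

  ⟨0,i⟩-vertex : ∀ {i} (i∈I : i ∈I) → ¬ i ≈ 0# → Vertex ⟨0, i∈I ⟩
  ⟨0,i⟩-vertex {i} i∈I i≉0 =
    (λ 0,i≈0 → i≉0 (proj₂ 0,i≈0)) , ⟨ i∈I ,0⟩ , (λ i,0≈0 → i≉0 (proj₁ i,0≈0)) , zeroˡ i , zeroʳ i

  ProdZero-⟨0,i⟩⇒snd≈0 : ∀ {i} (i∈I : i ∈I) → ¬ ZeroDivisor R i
    → ∀ {z w} → ProdZero z w → w ≈D ⟨0, i∈I ⟩ → ¬ ¬ (proj₂ (proj₁ z) ≈ 0#)
  ProdZero-⟨0,i⟩⇒snd≈0 {i} i∈I i-reg {(_ , b) , _} {(_ , d) , _} (_ , bd≈0) (_ , d≈i) =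
    ¬ZeroDivisor⇒Ann≈0 R i-reg (begin
      b * i ≈⟨ *-congˡ (sym d≈i) ⟩
      b * d ≈⟨ bd≈0 ⟩
      0#    ∎)

  diag-far-from-⟨0,i⟩ : ∀ {i y} (i∈I : i ∈I) → ¬ ZeroDivisor R i → ¬ y ≈ 0#
    → (∀ x → Ann R y x → x ∈I → x ≈ 0#)
    → ¬ DistLe _≈D_ Vertex Adjacent (diag y) ⟨0, i∈I ⟩ 2
  diag-far-from-⟨0,i⟩ {y = y} i∈I i-reg y≉0 Ann∩I≈0 =
    ¬DistLe2 y,y≉0,i y,y≁0,i y,y≁≁0,i
    where
    y,y≉0,i : ¬ diag y ≈D ⟨0, i∈I ⟩
    y,y≉0,i (y≈0 , _) = y≉0 y≈0

    y,y≁0,i : ∀ z → Adjacent (diag y) z → ¬ z ≈D ⟨0, i∈I ⟩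
    y,y≁0,i z (_ , _ , _ , yz≈0) z≈0,i =
      ProdZero-⟨0,i⟩⇒snd≈0 i∈I i-reg {diag y} {z} yz≈0 z≈0,i y≉0

    y,y≁≁0,i : ∀ z w → Adjacent (diag y) z → Adjacent z w → ¬ w ≈D ⟨0, i∈I ⟩
    y,y≁≁0,i z@((a , b) , _) w (_ , (z≉0 , _) , _ , ya≈0 , _) (_ , _ , _ , zw≈0) w≈0,i =
      ProdZero-⟨0,i⟩⇒snd≈0 i∈I i-reg {z} {w} zw≈0 w≈0,i λ b≈0 →
        z≉0 (Ann∩I≈0 a (trans (*-comm a y) ya≈0) (snd≈0⇒fst∈I z b≈0) , b≈0)

lemma4p15 : ∀ {c ℓ p : Level} (R : CommutativeRing c ℓ) (I : Ideal R p)
            → Σ (CommutativeRing.Carrier R) (λ i → Ideal._∈I I i × ¬ ZeroDivisor R i)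
            → Dup.DiamΓ≡2 R I
            → ∀ (y : CommutativeRing.Carrier R)
            → ZeroDivisor R y
            → ¬ CommutativeRing._≈_ R y (CommutativeRing.0# R)
            → ¬ (∀ (x : CommutativeRing.Carrier R) → Ann R y x → Ideal._∈I I x → CommutativeRing._≈_ R x (CommutativeRing.0# R))
lemma4p15 R I (i , i∈I , i-reg) (within2 , _) y y∈Z y≉0 Ann∩I≈0 =
  diag-far-from-⟨0,i⟩ i∈I i-reg y≉0 Ann∩I≈0
    (within2 (diag y) ⟨0, i∈I ⟩ (diag-vertex y∈Z y≉0) (⟨0,i⟩-vertex i∈I (¬ZeroDivisor⇒≉0 R i-reg)))
  where open ZeroDivisorGraph R I
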